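{- $b(2,1;2)=10$.
   Context: A family of sets is a set $F$ of sets. $F$ has the $[d,1]$-property if $|A\cap B|\le d$ for all distinct $A,B\in F$. A set $X$ with $|X|\le t$ is a $t$-transversal of $F$ if it meets every member of $F$. $F$ has the $t$-property if for every $A\in F$ the family $F\setminus\{A\}$ has a $t$-transversal $X$ with $X\cap A=\emptyset$. $b(d,1;t)$ is the supremum of $|F|$ over all families with the $[d,1]$-property and the $t$-property. -}

module Defs where

open import Data.Nat using (ℕ; _≤_)
open import Data.List using (List; length)
open import Data.List.Relation.Unary.All using (All)
open import Data.List.Relation.Unary.Any using (Any)
open import Data.Product using (Σ; _×_)
open import Data.Empty using (⊥)
open import Relation.Nullary using (¬_)
open import Relation.Binary.PropositionalEquality using (_≡_; _≢_)

SetOf : Set → Set₁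
SetOf U = U → Set

_≐_ : {U : Set} → SetOf U → SetOf U → Set
A ≐ B = ∀ u → (A u → B u) × (B u → A u)

-- A family of sets is given as an indexed family F : I → SetOf U whose
-- members are pairwise distinct (so it is a *set* of sets, |F| = |I|).
IsFamily : {U I : Set} → (I → SetOf U) → Set
IsFamily {I = I} F = ∀ (i j : I) → F i ≐ F j → i ≡ j

-- |A ∩ B| ≤ d, here for d = 2: no three pairwise distinct common elements.
InterAtMost2 : {U : Set} → SetOf U → SetOf U → Set
InterAtMost2 {U} A B =
  ∀ (x y z : U) → x ≢ y → y ≢ z → x ≢ z →
  A x → A y → A z → B x → B y → B z → ⊥

Prop21 : {U I : Set} → (I → SetOf U) → Set
Prop21 {I = I} F = ∀ (i j : I) → i ≢ j → InterAtMost2 (F i) (F j)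

-- t-property: for every member A = F i, the family F \ {A} has a
-- t-transversal X (a set of at most t elements meeting every member of
-- F \ {A}) with X ∩ A = ∅.
TProp : {U I : Set} → ℕ → (I → SetOf U) → Set
TProp {U} {I} t F =
  ∀ (i : I) → Σ (List U) λ X →
    (length X ≤ t) ×
    (All (λ x → ¬ F i x) X) ×
    (∀ (j : I) → j ≢ i → Any (F j) X)

module Submission where

-- Picking, for each member A i, a 2-transversal {x i, y i} of
-- the other members that misses A i turns a family into a `System`.  We show
-- b(0,1;2) ≤ 3, b(1,1;2) ≤ 6 and b(2,1;2) ≤ 10 in turn (`bound₀`, `bound₁`,
-- `bound₂`).  For d = 1, 2, if a point v lies on the pairs of d + 1 members,
-- the other points of those pairs ("partners" of v) are distinct and lie in
-- every further member missing v, so few members miss v (`fewMiss₁`, `fewMiss₃`; for d = 2 a point on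
-- exactly two pairs needs a finer count, `fewMiss₂`).  Then many members
-- contain v, and deleting v from them gives a system for d - 1 (`viaLink`).
-- If no point lies on two pairs, the pair of each member outside a fixed
-- triangle of members puts a point into both ends of some edge of it; by
-- pigeonhole some edge receives d + 1 distinct points (`separated₁`,
-- `separated₂`).  The members are arbitrary predicates, so these case splits
-- are classical; they are made under a double negation, which is harmless
-- as the goal is ⊥.
--
-- Lower bound.  The ten 3-subsets of a 5-set, each transversed by its
-- complement, checked by evaluating decision procedures.

open import Defs
open import Data.Nat using (ℕ; zero; suc; _+_; _*_; _≤_; _<_; s≤s)
open import Data.Nat.Properties using (+-suc; *-suc; m≤m+n; n≤1+n; ≤-refl; ≤-trans; ≤-reflexive)
open import Data.Fin using (Fin; zero; suc; punchIn; punchOut; inject≤; _↑ˡ_; _↑ʳ_; _≟_; #_)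
open import Data.Fin.Properties
  using (suc-injective; punchIn-injective; punchInᵢ≢i; punchOut-injective; inject≤-injective;
         ↑ˡ-injective; ↑ʳ-injective; <⇒≢; pigeonhole; all?; any?)
open import Data.List using (List; []; _∷_; _++_; length; tabulate)
open import Data.List.Membership.Propositional using (_∉_)
open import Data.List.Relation.Unary.All as All using (All; []; _∷_)
open import Data.List.Relation.Unary.All.Properties using (++⁻; tabulate⁻)
open import Data.List.Relation.Unary.Any as Any using (Any; here; there)
open import Data.Vec using (Vec; lookup; []; _∷_)
open import Data.Product using (Σ; _×_; _,_; proj₁; proj₂)
open import Data.Sum using (_⊎_; inj₁; inj₂; fromInj₁; fromInj₂)
import Data.Sum as Sum
open import Data.Empty using (⊥; ⊥-elim)
open import Function using (id; _∘_)
open import Function.Definitions using (Injective)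
open import Relation.Nullary using (¬_; Dec; yes; no; ¬?)
open import Relation.Nullary.Decidable
  using (_×-dec_; _→-dec_; toWitness; decidable-stable; ¬¬-excluded-middle)
open import Relation.Binary.PropositionalEquality using (_≡_; _≢_; refl; sym; trans; subst; cong)

-- ¬¬ commutes with a finite universal quantifier; this lets us decide
-- finitely many propositions at once while proving ⊥.
¬¬-∀-Fin : ∀ {n} {P : Fin n → Set} → (∀ i → ¬ ¬ P i) → ¬ ¬ (∀ i → P i)
¬¬-∀-Fin {zero}  _   k = k λ ()
¬¬-∀-Fin {suc n} ¬¬P k =
  ¬¬P zero λ p₀ → ¬¬-∀-Fin (λ i → ¬¬P (suc i)) λ ps → k λ { zero → p₀ ; (suc i) → ps i }

Many : ∀ {n} → ℕ → (Fin n → Set) → Set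
Many {n} k P = Σ (Fin k → Fin n) λ h → Injective _≡_ _≡_ h × (∀ i → P (h i))

adjoin : ∀ {k n} → Fin (suc n) → (Fin k → Fin n) → Fin (suc k) → Fin (suc n)
adjoin i h zero    = i
adjoin i h (suc t) = punchIn i (h t)

adjoin-injective : ∀ {k n} (i : Fin (suc n)) {h : Fin k → Fin n} →
                   Injective _≡_ _≡_ h → Injective _≡_ _≡_ (adjoin i h)
adjoin-injective i h-inj {zero}  {zero}  _ = refl
adjoin-injective i h-inj {zero}  {suc t} e = ⊥-elim (punchInᵢ≢i i _ (sym e))
adjoin-injective i h-inj {suc t} {zero}  e = ⊥-elim (punchInᵢ≢i i _ e)
adjoin-injective i h-inj {suc t} {suc u} e =
  cong suc (h-inj (punchIn-injective i _ _ e))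

manyHolds : ∀ r {m} {P : Fin (r + m) → Set} → (∀ i → Dec (P i)) →
            ¬ Many (suc r) (λ i → ¬ P i) → Many m P
manyHolds zero P? fewFailures =
  id , id , λ i → decidable-stable (P? i) λ ¬Pi →
    fewFailures ((λ _ → i) , (λ { {zero} {zero} _ → refl }) , λ _ → ¬Pi)
manyHolds (suc r) {P = P} P? fewFailures with any? (λ i → ¬? (P? i))
... | yes (i , ¬Pi) =
  let (h , h-inj , Ph) = manyHolds r (P? ∘ punchIn i) fewerFailures
  in punchIn i ∘ h , h-inj ∘ punchIn-injective i _ _ , Ph
  where
  fewerFailures : ¬ Many (suc r) (λ j → ¬ P (punchIn i j))
  fewerFailures (h , h-inj , ¬Ph) =
    fewFailures (adjoin i h , adjoin-injective i h-inj , λ { zero → ¬Pi ; (suc t) → ¬Ph t })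
... | no noFailure =
  (suc r ↑ʳ_) , ↑ʳ-injective (suc r) _ _ , λ j → decidable-stable (P? _) λ ¬Pj → noFailure (_ , ¬Pj)

-- Among k distinct values h i at most |as| lie in the list as, so when
-- |as| + m ≤ k there are m distinct indices whose values avoid as.
-- (Opaque, like threeEqual below: only the statement is used, and letting
-- the type checker unfold the proof is needlessly expensive.)
opaque
  avoiding : ∀ {N k m} (as : List (Fin N)) (h : Fin k → Fin N) → Injective _≡_ _≡_ h →
             length as + m ≤ k → Many m (λ i → All (h i ≢_) as)
  avoiding [] h h-inj le = (λ i → inject≤ i le) , inject≤-injective le le _ _ , λ _ → []
  avoiding {m = m} (a ∷ as) h h-inj le
    with avoiding {m = suc m} as h h-inj (≤-trans (≤-reflexive (+-suc (length as) m)) le)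
  ... | g , g-inj , avoid with any? (λ t → h (g t) ≟ a)
  ... | yes (t , hgt≡a) =
    g ∘ punchIn t , punchIn-injective t _ _ ∘ g-inj ,
    λ i → (λ e → punchInᵢ≢i t i (g-inj (h-inj (trans e (sym hgt≡a))))) ∷ avoid (punchIn t i)
  ... | no none = g ∘ suc , suc-injective ∘ g-inj , λ i → (λ e → none (suc i , e)) ∷ avoid (suc i)

ThreeEqual : ∀ {n m} → (Fin n → Fin m) → Set
ThreeEqual {n} f = Σ (Fin n) λ i → Σ (Fin n) λ j → Σ (Fin n) λ k →
  i ≢ j × j ≢ k × i ≢ k × f i ≡ f j × f j ≡ f k

-- Take two points in one box; if no third point
-- joins them, delete both points and the box and recurse.
opaque
  threeEqual : ∀ {n} m → 2 * m < n → (f : Fin n → Fin m) → ThreeEqual f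
  threeEqual zero (s≤s _) f with f zero
  ... | ()
  threeEqual {n} (suc m) 2m<n f
    with pigeonhole (≤-trans (s≤s (m≤m+n (suc m) _)) 2m<n) f
  ... | i , j , i<j , fi≡fj with any? (λ k → (¬? (k ≟ i) ×-dec ¬? (k ≟ j)) ×-dec (f k ≟ f i))
  ... | yes (k , (k≢i , k≢j) , fk≡fi) =
    i , j , k , <⇒≢ i<j , k≢j ∘ sym , k≢i ∘ sym , fi≡fj , trans (sym fi≡fj) (sym fk≡fi)
  ... | no noThird =
    let (a , b , c , a≢b , b≢c , a≢c , e₁ , e₂) = threeEqual m ≤-refl f′
    in g a , g b , g c , a≢b ∘ g-inj , b≢c ∘ g-inj , a≢c ∘ g-inj ,
       punchOut-injective (outsideBox a) (outsideBox b) e₁ ,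
       punchOut-injective (outsideBox b) (outsideBox c) e₂
    where
    rest : Many (suc (2 * m)) (λ t → All (t ≢_) (i ∷ j ∷ []))
    rest = avoiding (i ∷ j ∷ []) id id (subst (λ l → suc l ≤ n) (*-suc 2 m) 2m<n)
    g : Fin (suc (2 * m)) → Fin n
    g = proj₁ rest
    g-inj : Injective _≡_ _≡_ g
    g-inj = proj₁ (proj₂ rest)
    outsideBox : ∀ t → f i ≢ f (g t)
    outsideBox t fi≡fgt =
      noThird (g t , (All.head avoid , All.head (All.tail avoid)) , sym fi≡fgt)
      where
      avoid : All (g t ≢_) (i ∷ j ∷ [])
      avoid = proj₂ (proj₂ rest) t
    f′ : Fin (suc (2 * m)) → Fin m
    f′ t = punchOut (outsideBox t)

-- The edges {0,1}, {0,2}, {1,2} of a triangle with corners Fin 3.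
end₁ end₂ : Fin 3 → Fin 3
end₁ zero             = zero
end₁ (suc zero)       = zero
end₁ (suc (suc zero)) = suc zero
end₂ zero             = suc zero
end₂ (suc zero)       = suc (suc zero)
end₂ (suc (suc zero)) = suc (suc zero)

end₁≢end₂ : ∀ e → end₁ e ≢ end₂ e
end₁≢end₂ zero             ()
end₁≢end₂ (suc zero)       ()
end₁≢end₂ (suc (suc zero)) ()

twoAgree : {P Q : Fin 3 → Set} → (∀ t → P t ⊎ Q t) →
           Σ (Fin 3) λ e → (P (end₁ e) × P (end₂ e)) ⊎ (Q (end₁ e) × Q (end₂ e))
twoAgree choice with choice zero | choice (suc zero) | choice (suc (suc zero))
... | inj₁ p | inj₁ q | _      = zero , inj₁ (p , q)
... | inj₂ p | inj₂ q | _      = zero , inj₂ (p , q)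
... | inj₁ p | inj₂ _ | inj₁ r = suc zero , inj₁ (p , r)
... | inj₂ p | inj₁ _ | inj₂ r = suc zero , inj₂ (p , r)
... | inj₂ _ | inj₁ q | inj₁ r = suc (suc zero) , inj₁ (q , r)
... | inj₁ _ | inj₂ q | inj₂ r = suc (suc zero) , inj₂ (q , r)

Disjoint : {U : Set} → SetOf U → SetOf U → Set
Disjoint {U} A B = ∀ (u : U) → A u → B u → ⊥

InterAtMost1 : {U : Set} → SetOf U → SetOf U → Set
InterAtMost1 {U} A B = ∀ (u w : U) → u ≢ w → A u → A w → B u → B w → ⊥

record System (n : ℕ) (U : Set) (Small : SetOf U → SetOf U → Set) : Set₁ where
  field
    A     : Fin n → SetOf U
    x y   : Fin n → U
    x∉A   : ∀ i → ¬ A i (x i)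
    y∉A   : ∀ i → ¬ A i (y i)
    meets : ∀ i j → i ≢ j → A j (x i) ⊎ A j (y i)
    small : ∀ i j → i ≢ j → Small (A i) (A j)

module _ {n : ℕ} {U : Set} {Small : SetOf U → SetOf U → Set} (C : System n U Small) where
  open System C

  On : U → Fin n → Set
  On v a = v ≡ x a ⊎ v ≡ y a

  on∉ : ∀ {v a} → On v a → ¬ A a v
  on∉ {a = a} (inj₁ refl) = x∉A a
  on∉ {a = a} (inj₂ refl) = y∉A a

  record Partner (v : U) (a : Fin n) : Set where
    field
      point  : U
      on     : On point a
      covers : ∀ j → j ≢ a → ¬ A j v → A j point

  partner : ∀ {v a} → On v a → Partner v a
  partner {a = a} (inj₁ refl) = record
    { point = y a ; on = inj₂ refl
    ; covers = λ j j≢a miss → fromInj₂ (⊥-elim ∘ miss) (meets a j (j≢a ∘ sym)) }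
  partner {a = a} (inj₂ refl) = record
    { point = x a ; on = inj₁ refl
    ; covers = λ j j≢a miss → fromInj₁ (⊥-elim ∘ miss) (meets a j (j≢a ∘ sym)) }

  -- The partners of v at two members differ: a common partner would lie
  -- outside A a, yet in A a since A a misses v.
  partners-distinct : ∀ {v a b} → a ≢ b → (oa : On v a) (ob : On v b) →
                      Partner.point (partner oa) ≢ Partner.point (partner ob)
  partners-distinct {a = a} a≢b oa ob same =
    on∉ (Partner.on (partner oa))
        (subst (A a) (sym same) (Partner.covers (partner ob) a a≢b (on∉ oa)))

  record SharedPoint (τ : Fin 3 → Fin n) (j : Fin n) : Set where
    constructor shared
    field
      edge  : Fin 3
      point : U
      on    : On point j
      in₁   : A (τ (end₁ edge)) point
      in₂   : A (τ (end₂ edge)) point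

  -- The pair of j meets all three corners of τ, so two corners agree on the
  -- point they contain.
  share : (τ : Fin 3 → Fin n) (j : Fin n) → (∀ t → τ t ≢ j) → SharedPoint τ j
  share τ j outside with twoAgree (λ t → meets j (τ t) (outside t ∘ sym))
  ... | e , inj₁ (p , q) = shared e (x j) (inj₁ refl) p q
  ... | e , inj₂ (p , q) = shared e (y j) (inj₂ refl) p q

  onEdge : ∀ {τ j e} (s : SharedPoint τ j) → SharedPoint.edge s ≡ e →
           A (τ (end₁ e)) (SharedPoint.point s) × A (τ (end₂ e)) (SharedPoint.point s)
  onEdge (shared _ _ _ p q) refl = p , q

  PointOnTwo : Set
  PointOnTwo = Σ U λ v → Σ (Fin n) λ a → Σ (Fin n) λ b → a ≢ b × On v a × On v b

  PointOnThree : Set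
  PointOnThree = Σ U λ v → Σ (Fin n) λ a → Σ (Fin n) λ b → Σ (Fin n) λ c →
    a ≢ b × b ≢ c × a ≢ c × On v a × On v b × On v c

  distinctPoints : ¬ PointOnTwo → ∀ {a b v w} → a ≢ b → On v a → On w b → v ≢ w
  distinctPoints apart a≢b ov ow refl = apart (_ , _ , _ , a≢b , ov , ow)

restrict : ∀ {n m U Small} → System n U Small → (h : Fin m → Fin n) → Injective _≡_ _≡_ h →
           System m U Small
restrict C h h-inj = record
  { A = A ∘ h ; x = x ∘ h ; y = y ∘ h ; x∉A = x∉A ∘ h ; y∉A = y∉A ∘ h
  ; meets = λ i j i≢j → meets (h i) (h j) (i≢j ∘ h-inj)
  ; small = λ i j i≢j → small (h i) (h j) (i≢j ∘ h-inj) }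
  where open System C

_∖_ : {U : Set} → SetOf U → U → SetOf U
(B ∖ v) u = B u × u ≢ v

Lowers : {U : Set} → (SetOf U → SetOf U → Set) → (SetOf U → SetOf U → Set) → Set₁
Lowers {U} Small Small′ =
  ∀ {B B′ : SetOf U} {v} → B v → B′ v → Small B B′ → Small′ (B ∖ v) (B′ ∖ v)

lower₁ : {U : Set} → Lowers {U} InterAtMost1 Disjoint
lower₁ {v = v} bv b′v small u (bu , u≢v) (b′u , _) = small u v u≢v bu bv b′u b′v

lower₂ : {U : Set} → Lowers {U} InterAtMost2 InterAtMost1
lower₂ {v = v} bv b′v small u w u≢w (bu , u≢v) (bw , w≢v) (b′u , _) (b′w , _) =
  small u w v u≢w w≢v u≢v bu bw bv b′u b′w b′v

-- The link of a system at a point v contained in all members: delete v.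
-- The transversal pairs survive, since they miss members containing v.
link : ∀ {n U Small Small′} (C : System n U Small) (v : U) → (∀ i → System.A C i v) →
       Lowers Small Small′ → System n U Small′
link C v contains lower = record
  { A = λ i → A i ∖ v ; x = x ; y = y
  ; x∉A = λ i → x∉A i ∘ proj₁ ; y∉A = λ i → y∉A i ∘ proj₁
  ; meets = λ i j i≢j → Sum.map (_, ≢v (x∉A i)) (_, ≢v (y∉A i)) (meets i j i≢j)
  ; small = λ i j i≢j → lower (contains i) (contains j) (small i j i≢j) }
  where
  open System C
  ≢v : ∀ {i u} → ¬ A i u → u ≢ v
  ≢v {i} u∉Ai refl = u∉Ai (contains i)

viaLink : ∀ r {m U Small Small′} (C : System (r + m) U Small) (v : U) →
          ¬ Many (suc r) (λ i → ¬ System.A C i v) → Lowers Small Small′ →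
          (System m U Small′ → ⊥) → ⊥
viaLink r C v fewMiss lower impossible =
  ¬¬-∀-Fin {P = λ i → Dec (System.A C i v)} (λ i → ¬¬-excluded-middle) λ decide →
    let (h , h-inj , contain) = manyHolds r decide fewMiss
    in impossible (link (restrict C h h-inj) v contain lower)

-- b(0,1;2) ≤ 3: the pair of member 0 meets members 1, 2, 3, so one of its
-- points lies in two of them.
bound₀ : ∀ {U} → System 4 U Disjoint → ⊥
bound₀ C with share C suc zero (λ t ())
... | shared e z _ p q = small (suc (end₁ e)) (suc (end₂ e)) (end₁≢end₂ e ∘ suc-injective) z p q
  where open System C

corner : ∀ {k} → Fin 3 → Fin (3 + k)
corner = _↑ˡ _

corner-injective : ∀ {k} → Injective _≡_ _≡_ (corner {k})
corner-injective = ↑ˡ-injective _ _ _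

sharedWithTriangle : ∀ {k U Small} (C : System (3 + k) U Small) (i : Fin k) →
                     SharedPoint C corner (3 ↑ʳ i)
sharedWithTriangle C i = share C corner (3 ↑ʳ i) (corner≢other i)
  where
  corner≢other : ∀ {k} (i : Fin k) (t : Fin 3) → corner t ≢ 3 ↑ʳ i
  corner≢other i zero             ()
  corner≢other i (suc zero)       ()
  corner≢other i (suc (suc zero)) ()

-- If v lies on the pairs of two members a, b, at most three members miss v:
-- of four such, two differ from a and b, and both contain the two distinct
-- partners of v.
fewMiss₁ : ∀ {n U} (C : System n U InterAtMost1) {v a b} → a ≢ b → On C v a → On C v b →
           ¬ Many 4 (λ i → ¬ System.A C i v)
fewMiss₁ {n} {U} C {a = a} {b} a≢b oa ob (h , h-inj , miss) =
  small (j zero) (j (suc zero)) ((λ ()) ∘ g-inj ∘ h-inj) wa wb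
        (partners-distinct C a≢b oa ob)
        (in-a zero) (in-b zero) (in-a (suc zero)) (in-b (suc zero))
  where
  open System C
  open Partner
  chosen : Many 2 (λ t → All (h t ≢_) (a ∷ b ∷ []))
  chosen = avoiding (a ∷ b ∷ []) h h-inj ≤-refl
  g : Fin 2 → Fin 4
  g = proj₁ chosen
  g-inj : Injective _≡_ _≡_ g
  g-inj = proj₁ (proj₂ chosen)
  j : Fin 2 → Fin n
  j = h ∘ g
  avoid : ∀ t → All (j t ≢_) (a ∷ b ∷ [])
  avoid = proj₂ (proj₂ chosen)
  wa wb : U
  wa = point (partner C oa)
  wb = point (partner C ob)
  in-a : ∀ t → A (j t) wa
  in-a t = covers (partner C oa) _ (All.head (avoid t)) (miss (g t))
  in-b : ∀ t → A (j t) wb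
  in-b t = covers (partner C ob) _ (All.head (All.tail (avoid t))) (miss (g t))

-- With no point on two pairs, two of the members 3, …, 6 use the same edge
-- of the triangle 0, 1, 2, putting two distinct points into both its ends.
separated₁ : ∀ {U} (C : System 7 U InterAtMost1) → ¬ PointOnTwo C → ⊥
separated₁ C apart with pigeonhole ≤-refl (SharedPoint.edge ∘ sharedWithTriangle C)
... | i , j , i<j , same =
  small (corner (end₁ e)) (corner (end₂ e)) (end₁≢end₂ e ∘ corner-injective)
        (point si) (point sj)
        (distinctPoints C apart (<⇒≢ i<j ∘ ↑ʳ-injective 3 i j) (on si) (on sj))
        (proj₁ in-i) (proj₁ in-j) (proj₂ in-i) (proj₂ in-j)
  where
  open System C
  open SharedPoint
  si : SharedPoint C corner (3 ↑ʳ i)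
  si = sharedWithTriangle C i
  sj : SharedPoint C corner (3 ↑ʳ j)
  sj = sharedWithTriangle C j
  e : Fin 3
  e = edge si
  in-i : A (corner (end₁ e)) (point si) × A (corner (end₂ e)) (point si)
  in-i = onEdge C si refl
  in-j : A (corner (end₁ e)) (point sj) × A (corner (end₂ e)) (point sj)
  in-j = onEdge C sj (sym same)

bound₁ : ∀ {U} → System 7 U InterAtMost1 → ⊥
bound₁ C = ¬¬-excluded-middle {A = PointOnTwo C} λ where
  (yes (v , a , b , a≢b , oa , ob)) → viaLink 3 C v (fewMiss₁ C a≢b oa ob) lower₁ bound₀
  (no apart)                         → separated₁ C apart

-- If v lies on the pairs of three members a, b, c, at most four members
-- miss v: of five such, two differ from a, b, c, and both contain the three
-- distinct partners of v.
fewMiss₃ : ∀ {n U} (C : System n U InterAtMost2) {v a b c} → a ≢ b → b ≢ c → a ≢ c →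
           On C v a → On C v b → On C v c → ¬ Many 5 (λ i → ¬ System.A C i v)
fewMiss₃ {n} {U} C {a = a} {b} {c} a≢b b≢c a≢c oa ob oc (h , h-inj , miss) =
  small (j zero) (j (suc zero)) ((λ ()) ∘ g-inj ∘ h-inj) wa wb wc
        (partners-distinct C a≢b oa ob) (partners-distinct C b≢c ob oc)
        (partners-distinct C a≢c oa oc)
        (in-a zero) (in-b zero) (in-c zero) (in-a (suc zero)) (in-b (suc zero)) (in-c (suc zero))
  where
  open System C
  open Partner
  chosen : Many 2 (λ t → All (h t ≢_) (a ∷ b ∷ c ∷ []))
  chosen = avoiding (a ∷ b ∷ c ∷ []) h h-inj ≤-refl
  g : Fin 2 → Fin 5
  g = proj₁ chosen
  g-inj : Injective _≡_ _≡_ g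
  g-inj = proj₁ (proj₂ chosen)
  j : Fin 2 → Fin n
  j = h ∘ g
  avoid : ∀ t → All (j t ≢_) (a ∷ b ∷ c ∷ [])
  avoid = proj₂ (proj₂ chosen)
  wa wb wc : U
  wa = point (partner C oa)
  wb = point (partner C ob)
  wc = point (partner C oc)
  in-a : ∀ t → A (j t) wa
  in-a t = covers (partner C oa) _ (All.head (avoid t)) (miss (g t))
  in-b : ∀ t → A (j t) wb
  in-b t = covers (partner C ob) _ (All.head (All.tail (avoid t))) (miss (g t))
  in-c : ∀ t → A (j t) wc
  in-c t = covers (partner C oc) _ (All.head (All.tail (All.tail (avoid t)))) (miss (g t))

-- If v lies on the pairs of two members a, b but no point lies on three
-- pairs, at most four members miss v.  Of five such, three (a triangle τ)
-- differ from a, b and contain both partners wa ≠ wb of v.  Three further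
-- members each put a point z of their pair into both ends of an edge of τ;
-- z is wa or wb, for otherwise that edge has three common points.  So two of
-- them carry the same partner on their pair, and with a (or b) this puts a
-- point on three pairs.
fewMiss₂ : ∀ {n U} (C : System n U InterAtMost2) → 8 ≤ n → ¬ PointOnThree C →
           ∀ {v a b} → a ≢ b → On C v a → On C v b → ¬ Many 5 (λ i → ¬ System.A C i v)
fewMiss₂ {n} {U} C 8≤n noThree {a = a} {b} a≢b oa ob (h , h-inj , miss) =
  ¬¬-∀-Fin side λ sides → onThree (twoAgree sides)
  where
  open System C
  open Partner
  wa wb : U
  wa = point (partner C oa)
  wb = point (partner C ob)
  triangle : Many 3 (λ t → All (h t ≢_) (a ∷ b ∷ []))
  triangle = avoiding (a ∷ b ∷ []) h h-inj ≤-refl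
  τ : Fin 3 → Fin n
  τ = h ∘ proj₁ triangle
  τ-inj : Injective _≡_ _≡_ τ
  τ-inj = proj₁ (proj₂ triangle) ∘ h-inj
  in-τ : ∀ t → A (τ t) wa × A (τ t) wb
  in-τ t = covers (partner C oa) _ (All.head avoid) (miss _) ,
           covers (partner C ob) _ (All.head (All.tail avoid)) (miss _)
    where
    avoid : All (τ t ≢_) (a ∷ b ∷ [])
    avoid = proj₂ (proj₂ triangle) t
  others : Many 3 (λ s → All (s ≢_) (tabulate τ ++ a ∷ b ∷ []))
  others = avoiding (tabulate τ ++ a ∷ b ∷ []) id id 8≤n
  j : Fin 3 → Fin n
  j = proj₁ others
  j-inj : Injective _≡_ _≡_ j
  j-inj = proj₁ (proj₂ others)
  outside : ∀ s → (∀ t → τ t ≢ j s) × a ≢ j s × b ≢ j s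
  outside s = (λ t → tabulate⁻ {f = τ} (proj₁ avoid) t ∘ sym) ,
              All.head (proj₂ avoid) ∘ sym , All.head (All.tail (proj₂ avoid)) ∘ sym
    where
    avoid : All (j s ≢_) (tabulate τ) × All (j s ≢_) (a ∷ b ∷ [])
    avoid = ++⁻ (tabulate τ) (proj₂ (proj₂ others) s)
  side : ∀ s → ¬ ¬ (On C wa (j s) ⊎ On C wb (j s))
  side s k with share C τ (j s) (proj₁ (outside s))
  ... | shared e z on-z in₁ in₂ = ¬¬-excluded-middle {A = z ≡ wa} λ where
    (yes refl) → k (inj₁ on-z)
    (no z≢wa)  → ¬¬-excluded-middle {A = z ≡ wb} λ where
      (yes refl) → k (inj₂ on-z)
      (no z≢wb)  →
        small (τ (end₁ e)) (τ (end₂ e)) (end₁≢end₂ e ∘ τ-inj) z wa wb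
              z≢wa (partners-distinct C a≢b oa ob) z≢wb
              in₁ (proj₁ (in-τ _)) (proj₂ (in-τ _)) in₂ (proj₁ (in-τ _)) (proj₂ (in-τ _))
  onThree : Σ (Fin 3) (λ e → (On C wa (j (end₁ e)) × On C wa (j (end₂ e)))
                           ⊎ (On C wb (j (end₁ e)) × On C wb (j (end₂ e)))) → ⊥
  onThree (e , inj₁ (o₁ , o₂)) =
    noThree (wa , a , j (end₁ e) , j (end₂ e) , proj₁ (proj₂ (outside _)) ,
             end₁≢end₂ e ∘ j-inj , proj₁ (proj₂ (outside _)) , on (partner C oa) , o₁ , o₂)
  onThree (e , inj₂ (o₁ , o₂)) =
    noThree (wb , b , j (end₁ e) , j (end₂ e) , proj₂ (proj₂ (outside _)) ,
             end₁≢end₂ e ∘ j-inj , proj₂ (proj₂ (outside _)) , on (partner C ob) , o₁ , o₂)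

-- With no point on two pairs, three of the members 3, …, 10 use the same
-- edge of the triangle 0, 1, 2, putting three distinct points into both its
-- ends.
separated₂ : ∀ {U} (C : System 11 U InterAtMost2) → ¬ PointOnTwo C → ⊥
separated₂ C apart with threeEqual 3 (n≤1+n 7) (SharedPoint.edge ∘ sharedWithTriangle C)
... | i , j , k , i≢j , j≢k , i≢k , same₁ , same₂ =
  small (corner (end₁ e)) (corner (end₂ e)) (end₁≢end₂ e ∘ corner-injective)
        (point si) (point sj) (point sk)
        (apart′ i≢j si sj) (apart′ j≢k sj sk) (apart′ i≢k si sk)
        (proj₁ in-i) (proj₁ in-j) (proj₁ in-k) (proj₂ in-i) (proj₂ in-j) (proj₂ in-k)
  where
  open System C
  open SharedPoint
  si : SharedPoint C corner (3 ↑ʳ i)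
  si = sharedWithTriangle C i
  sj : SharedPoint C corner (3 ↑ʳ j)
  sj = sharedWithTriangle C j
  sk : SharedPoint C corner (3 ↑ʳ k)
  sk = sharedWithTriangle C k
  e : Fin 3
  e = edge si
  in-i : A (corner (end₁ e)) (point si) × A (corner (end₂ e)) (point si)
  in-i = onEdge C si refl
  in-j : A (corner (end₁ e)) (point sj) × A (corner (end₂ e)) (point sj)
  in-j = onEdge C sj (sym same₁)
  in-k : A (corner (end₁ e)) (point sk) × A (corner (end₂ e)) (point sk)
  in-k = onEdge C sk (sym (trans same₁ same₂))
  apart′ : ∀ {p q : Fin 8} → p ≢ q → (sp : SharedPoint C corner (3 ↑ʳ p))
           (sq : SharedPoint C corner (3 ↑ʳ q)) → point sp ≢ point sq
  apart′ p≢q sp sq = distinctPoints C apart (p≢q ∘ ↑ʳ-injective 3 _ _) (on sp) (on sq)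

bound₂ : ∀ {U} → System 11 U InterAtMost2 → ⊥
bound₂ C = ¬¬-excluded-middle {A = PointOnThree C} λ where
  (yes (v , a , b , c , a≢b , b≢c , a≢c , oa , ob , oc)) →
    viaLink 4 C v (fewMiss₃ C a≢b b≢c a≢c oa ob oc) lower₂ bound₁
  (no noThree) → ¬¬-excluded-middle {A = PointOnTwo C} λ where
    (yes (v , a , b , a≢b , oa , ob)) →
      viaLink 4 C v (fewMiss₂ C (m≤m+n 8 3) noThree a≢b oa ob) lower₂ bound₁
    (no apart) → separated₂ C apart

-- A transversal of at most two points which meets some set is a pair
-- {x, y} (with x = y for a single point), as far as meeting and missing sets
-- is concerned.
record AsPair {U : Set} (X : List U) : Set₁ where
  field
    x y  : U
    any⇒ : ∀ {B : SetOf U} → Any B X → B x ⊎ B y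
    all⇒ : ∀ {B : SetOf U} → All B X → B x × B y

asPair : ∀ {U} {B : SetOf U} (X : List U) → length X ≤ 2 → Any B X → AsPair X
asPair (u ∷ []) _ _ = record
  { x = u ; y = u
  ; any⇒ = λ { (here p) → inj₁ p ; (there ()) }
  ; all⇒ = λ { (p ∷ []) → p , p } }
asPair (u ∷ w ∷ []) _ _ = record
  { x = u ; y = w
  ; any⇒ = λ { (here p) → inj₁ p ; (there (here q)) → inj₂ q ; (there (there ())) }
  ; all⇒ = λ { (p ∷ q ∷ []) → p , q } }
asPair (_ ∷ _ ∷ _ ∷ _) (s≤s (s≤s ())) _

toSystem : ∀ {U I n} {F : I → SetOf U} → Prop21 F → TProp 2 F →
           (g : Fin n → I) → Injective _≡_ _≡_ g → (∀ i → Σ (Fin n) λ j → j ≢ i) →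
           System n U InterAtMost2
toSystem {U} {_} {n} {F} p21 tp g g-inj another = record
  { A = F ∘ g ; x = AsPair.x ∘ pair ; y = AsPair.y ∘ pair
  ; x∉A = λ i → proj₁ (AsPair.all⇒ (pair i) (avoids i))
  ; y∉A = λ i → proj₂ (AsPair.all⇒ (pair i) (avoids i))
  ; meets = λ i j i≢j → AsPair.any⇒ (pair i) (hits i j i≢j)
  ; small = λ i j i≢j → p21 (g i) (g j) (i≢j ∘ g-inj) }
  where
  X : Fin n → List U
  X i = proj₁ (tp (g i))
  avoids : ∀ i → All (λ u → ¬ F (g i) u) (X i)
  avoids i = proj₁ (proj₂ (proj₂ (tp (g i))))
  hits : ∀ i j → i ≢ j → Any (F (g j)) (X i)
  hits i j i≢j = proj₂ (proj₂ (proj₂ (tp (g i)))) (g j) (λ e → i≢j (sym (g-inj e)))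
  pair : ∀ i → AsPair (X i)
  pair i = asPair (X i) (proj₁ (proj₂ (tp (g i)))) (hits i _ (λ e → proj₂ (another i) (sym e)))

-- The upper bound b(2,1;2) ≤ 10.  (Distinctness of the members as sets is
-- not needed; distinct indices suffice.)
noElevenMembers : ∀ (U I : Set) (F : I → SetOf U) → IsFamily F → Prop21 F → TProp 2 F →
                  (g : Fin 11 → I) → Injective _≡_ _≡_ g → ⊥
noElevenMembers U I F _ p21 tp g g-inj = bound₂ (toSystem p21 tp g g-inj another)
  where
  another : ∀ (i : Fin 11) → Σ (Fin 11) λ j → j ≢ i
  another zero    = suc zero , λ ()
  another (suc _) = zero , λ ()

DecSet : ∀ {k} → SetOf (Fin k) → Set
DecSet A = ∀ u → Dec (A u)

≐? : ∀ {k} {A B : SetOf (Fin k)} → DecSet A → DecSet B → Dec (A ≐ B)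
≐? A? B? = all? λ u → (A? u →-dec B? u) ×-dec (B? u →-dec A? u)

interAtMost2? : ∀ {k} {A B : SetOf (Fin k)} → DecSet A → DecSet B → Dec (InterAtMost2 A B)
interAtMost2? A? B? =
  all? λ u → all? λ v → all? λ w →
    ¬? (u ≟ v) →-dec ¬? (v ≟ w) →-dec ¬? (u ≟ w) →-dec
    A? u →-dec A? v →-dec A? w →-dec B? u →-dec B? v →-dec B? w →-dec no λ ()

pairs : Vec (Fin 5 × Fin 5) 10
pairs = (# 0 , # 1) ∷ (# 0 , # 2) ∷ (# 0 , # 3) ∷ (# 0 , # 4) ∷ (# 1 , # 2)
      ∷ (# 1 , # 3) ∷ (# 1 , # 4) ∷ (# 2 , # 3) ∷ (# 2 , # 4) ∷ (# 3 , # 4) ∷ []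

pairList : Fin 10 → List (Fin 5)
pairList i = proj₁ (lookup pairs i) ∷ proj₂ (lookup pairs i) ∷ []

threeSet : Fin 10 → SetOf (Fin 5)
threeSet i u = u ∉ pairList i

threeSet? : ∀ i → DecSet (threeSet i)
threeSet? i u = ¬? (Any.any? (u ≟_) (pairList i))

threeSets-family : IsFamily threeSet
threeSets-family = toWitness {a? = all? λ i → all? λ j →
  ≐? (threeSet? i) (threeSet? j) →-dec (i ≟ j)} _

threeSets-[2,1] : Prop21 threeSet
threeSets-[2,1] = toWitness {a? = all? λ i → all? λ j →
  ¬? (i ≟ j) →-dec interAtMost2? (threeSet? i) (threeSet? j)} _

threeSets-2 : TProp 2 threeSet
threeSets-2 i = pairList i , ≤-refl , All.tabulate (λ u∈ u∉ → u∉ u∈) , othersMeet i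
  where
  othersMeet : ∀ i j → j ≢ i → Any (threeSet j) (pairList i)
  othersMeet = toWitness {a? = all? λ i → all? λ j →
    ¬? (j ≟ i) →-dec Any.any? (threeSet? j) (pairList i)} _

lemma17 : (∀ (U I : Set) (F : I → SetOf U) → IsFamily F → Prop21 F → TProp 2 F →
             (g : Fin 11 → I) → Injective _≡_ _≡_ g → ⊥)
          × (Σ Set λ U → Σ (Fin 10 → SetOf U) λ F →
               IsFamily F × Prop21 F × TProp 2 F)
lemma17 = noElevenMembers , (Fin 5 , threeSet , threeSets-family , threeSets-[2,1] , threeSets-2)
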